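{- Let $D$ be a dendriform algebra over a field $k$ of characteristic zero and $\overline D=D\oplus k\mathbf 1$ its unital augmentation. Let $a,b\in D$ and let $A,B\in\overline D[[\lambda]]$ satisfy $A=\mathbf 1+\lambda\, A\succ a$ and $B=\mathbf 1+\lambda\, B\succ b$. For $W\in\overline D[[\lambda]]$ with constant term $\mathbf 1$ and $x\in D[[\lambda]]$ put $\Theta_W(x):=W\succ x\prec W^{ -1}$. Then for all $x\in D[[\lambda]]$: (1) $\Theta_A(\Theta_B(x))=\Theta_{A*B}(x)$; (2) $\Theta_A(\Theta_{A^{ -1}}(x))=\Theta_{A^{ -1}}(\Theta_A(x))=x$.
   Context: A dendriform algebra over $k$ is a $k$-vector space $D$ with bilinear operations $\prec,\succ$ such that for all $a,b,c\in D$: $(a\prec b)\prec c=a\prec(b\prec c+b\succ c)$, $(a\succ b)\prec c=a\succ(b\prec c)$, $a\succ(b\succ c)=(a\prec b+a\succ b)\succ c$. The product $a*b:=a\prec b+a\succ b$ is associative. The augmentation $\overline D=D\oplus k\mathbf 1$ is defined by $a\prec\mathbf 1=a=\mathbf 1\succ a$ and $\mathbf 1\prec a=0=a\succ\mathbf 1$ for $a\in D$ ($\mathbf 1\prec\mathbf 1$, $\mathbf 1\succ\mathbf 1$ undefined), with $\mathbf 1*\mathbf 1=\mathbf 1$. Operations extend $\lambda$-bilinearly to $\overline D[[\lambda]]$; $W^{ -1}$ denotes the $*$-inverse of $W$, and $W\succ x\prec W^{ -1}$ means $(W\succ x)\prec W^{ -1}=W\succ(x\prec W^{ -1})$. -}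

module Defs where

open import Level using (Level; _⊔_)
open import Data.Nat using (ℕ; zero; suc; _∸_)
open import Data.Product using (∃)
open import Relation.Binary.PropositionalEquality using (_≡_)
open import Relation.Nullary using (¬_)
open import Algebra.Bundles using (CommutativeRing)
open import Algebra.Module.Bundles using (Module)

module _ {c ℓ : Level} (R : CommutativeRing c ℓ) where
  open CommutativeRing R

  record IsField : Set (c ⊔ ℓ) where
    field
      0≉1   : ¬ (0# ≈ 1#)
      inv   : ∀ x → ¬ (x ≈ 0#) → ∃ λ y → x * y ≈ 1#

  natR : ℕ → Carrier
  natR zero    = 0#
  natR (suc n) = 1# + natR n

  CharZero : Set ℓ
  CharZero = ∀ n → natR n ≈ 0# → n ≡ 0

module _ {c ℓ m ℓm : Level} {R : CommutativeRing c ℓ} (M : Module R m ℓm) where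
  open CommutativeRing R
  open Module M

  record Dendriform : Set (c ⊔ m ⊔ ℓm) where
    infixl 7 _≺_ _≻_
    field
      _≺_ _≻_ : Carrierᴹ → Carrierᴹ → Carrierᴹ
      ≺-cong : ∀ {x x' y y'} → x ≈ᴹ x' → y ≈ᴹ y' → (x ≺ y) ≈ᴹ (x' ≺ y')
      ≻-cong : ∀ {x x' y y'} → x ≈ᴹ x' → y ≈ᴹ y' → (x ≻ y) ≈ᴹ (x' ≻ y')
      ≺-+ˡ : ∀ x y z → ((x +ᴹ y) ≺ z) ≈ᴹ ((x ≺ z) +ᴹ (y ≺ z))
      ≺-+ʳ : ∀ x y z → (x ≺ (y +ᴹ z)) ≈ᴹ ((x ≺ y) +ᴹ (x ≺ z))
      ≻-+ˡ : ∀ x y z → ((x +ᴹ y) ≻ z) ≈ᴹ ((x ≻ z) +ᴹ (y ≻ z))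
      ≻-+ʳ : ∀ x y z → (x ≻ (y +ᴹ z)) ≈ᴹ ((x ≻ y) +ᴹ (x ≻ z))
      ≺-*ˡ : ∀ (r : Carrier) x y → ((r *ₗ x) ≺ y) ≈ᴹ (r *ₗ (x ≺ y))
      ≺-*ʳ : ∀ (r : Carrier) x y → (x ≺ (r *ₗ y)) ≈ᴹ (r *ₗ (x ≺ y))
      ≻-*ˡ : ∀ (r : Carrier) x y → ((r *ₗ x) ≻ y) ≈ᴹ (r *ₗ (x ≻ y))
      ≻-*ʳ : ∀ (r : Carrier) x y → (x ≻ (r *ₗ y)) ≈ᴹ (r *ₗ (x ≻ y))
      dend₁ : ∀ a b c → ((a ≺ b) ≺ c) ≈ᴹ (a ≺ ((b ≺ c) +ᴹ (b ≻ c)))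
      dend₂ : ∀ a b c → ((a ≻ b) ≺ c) ≈ᴹ (a ≻ (b ≺ c))
      dend₃ : ∀ a b c → (a ≻ (b ≻ c)) ≈ᴹ (((a ≺ b) +ᴹ (a ≻ b)) ≻ c)

module Aug {c ℓ m ℓm : Level} {R : CommutativeRing c ℓ} {M : Module R m ℓm}
           (Dd : Dendriform M) where
  open CommutativeRing R
  open Module M
  open Dendriform Dd

  _∗_ : Carrierᴹ → Carrierᴹ → Carrierᴹ
  x ∗ y = (x ≺ y) +ᴹ (x ≻ y)

  -- element  d + r·1  of D̄
  record D̄ : Set (c ⊔ m) where
    constructor ⟨_,_⟩
    field
      vec : Carrierᴹ
      sca : Carrier
  open D̄ public

  infix 4 _≈̄_
  record _≈̄_ (u v : D̄) : Set (ℓ ⊔ ℓm) where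
    field
      vec≈ : vec u ≈ᴹ vec v
      sca≈ : sca u ≈ sca v

  0̄ 1̄ : D̄
  0̄ = ⟨ 0ᴹ , 0# ⟩
  1̄ = ⟨ 0ᴹ , 1# ⟩

  ι : Carrierᴹ → D̄
  ι x = ⟨ x , 0# ⟩

  _+̄_ : D̄ → D̄ → D̄
  ⟨ d , r ⟩ +̄ ⟨ e , s ⟩ = ⟨ d +ᴹ e , r + s ⟩

  -- the (defined) mixed operations of D̄:
  --   (d + r1) ≻ x = d ≻ x + r x      (1 ≻ x = x)
  --   x ≺ (e + s1) = x ≺ e + s x      (x ≺ 1 = x)
  _̄≻_ : D̄ → Carrierᴹ → Carrierᴹ
  ⟨ d , r ⟩ ̄≻ x = (d ≻ x) +ᴹ (r *ₗ x)

  _≺̄_ : Carrierᴹ → D̄ → Carrierᴹ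
  x ≺̄ ⟨ e , s ⟩ = (x ≺ e) +ᴹ (s *ₗ x)

  _∗̄_ : D̄ → D̄ → D̄
  ⟨ d , r ⟩ ∗̄ ⟨ e , s ⟩ = ⟨ (d ∗ e) +ᴹ ((s *ₗ d) +ᴹ (r *ₗ e)) , r * s ⟩

  sumᴹ : ℕ → (ℕ → Carrierᴹ) → Carrierᴹ
  sumᴹ zero    f = f 0
  sumᴹ (suc n) f = sumᴹ n f +ᴹ f (suc n)

  sum̄ : ℕ → (ℕ → D̄) → D̄
  sum̄ zero    f = f 0
  sum̄ (suc n) f = sum̄ n f +̄ f (suc n)

  -- power series: D[[λ]] and D̄[[λ]] as coefficient sequences
  PS : Set m
  PS = ℕ → Carrierᴹ

  PS̄ : Set (c ⊔ m)
  PS̄ = ℕ → D̄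

  infix 4 _≈ₚ_ _≈̄ₚ_
  _≈ₚ_ : PS → PS → Set ℓm
  f ≈ₚ g = ∀ n → f n ≈ᴹ g n

  _≈̄ₚ_ : PS̄ → PS̄ → Set (ℓ ⊔ ℓm)
  f ≈̄ₚ g = ∀ n → f n ≈̄ g n

  -- λ-bilinear extensions (Cauchy products)
  _≻ₚ_ : PS̄ → PS → PS
  (W ≻ₚ x) n = sumᴹ n (λ i → W i ̄≻ x (n ∸ i))

  _≺ₚ_ : PS → PS̄ → PS
  (x ≺ₚ W) n = sumᴹ n (λ i → x i ≺̄ W (n ∸ i))

  _∗ₚ_ : PS̄ → PS̄ → PS̄
  (U ∗ₚ V) n = sum̄ n (λ i → U i ∗̄ V (n ∸ i))

  _+̄ₚ_ : PS̄ → PS̄ → PS̄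
  (U +̄ₚ V) n = U n +̄ V n

  constᴹ : Carrierᴹ → PS
  constᴹ a zero    = a
  constᴹ a (suc n) = 0ᴹ

  1ₚ : PS̄
  1ₚ zero    = 1̄
  1ₚ (suc n) = 0̄

  ιₚ : PS → PS̄
  ιₚ x n = ι (x n)

  λ·_ : PS̄ → PS̄
  (λ· U) zero    = 0̄
  (λ· U) (suc n) = U n

  IsInverse : PS̄ → PS̄ → Set (ℓ ⊔ ℓm)
  IsInverse W Wi = ((W ∗ₚ Wi) ≈̄ₚ 1ₚ) × ((Wi ∗ₚ W) ≈̄ₚ 1ₚ)
    where open import Data.Product using (_×_)

  -- Θ_W(x) = W ≻ x ≺ W⁻¹, with W⁻¹ supplied as Wi
  Θ : PS̄ → PS̄ → PS → PS
  Θ W Wi x = (W ≻ₚ x) ≺ₚ Wi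

-- Left multiplication W ≻ₚ_ and right multiplication _≺ₚ W are commuting actions of the
-- associative algebra (D̄[[λ]], ∗ₚ, 1ₚ) on D[[λ]]: the third dendriform axiom makes ≻ a left
-- action, the first makes ≺ a right action, and the second says they commute. The
-- conjugation Θ_W x = W ≻ x ≺ W⁻¹ is therefore an action of the group of ∗ₚ-units, which
-- gives both (1) and (2) for arbitrary invertible series.
module Submission where

open import Defs
open import Data.Product using (_×_; _,_)
open import Algebra.Bundles using (CommutativeRing; CommutativeMonoid)
open import Algebra.Module.Bundles using (Module)
open import Data.Nat using (ℕ; zero; suc; _∸_; _+_; _≤_; _<_; z≤n; s≤s)
open import Data.Nat.Properties
  using (≤-refl; m≤n⇒m≤1+n; ∸-+-assoc; +-∸-assoc; m+[n∸m]≡n; n∸n≡0; m<n⇒0<n∸m)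
open import Relation.Binary.Bundles using (Setoid)
open import Relation.Binary.PropositionalEquality as P using (_≡_)
import Algebra.Properties.CommutativeSemigroup as CommutativeSemigroupProperties
import Relation.Binary.Reasoning.Setoid as SetoidReasoning

module DendriformActions {c ℓ m ℓm} {R : CommutativeRing c ℓ} {M : Module R m ℓm}
                         (Dd : Dendriform M) where
  open CommutativeRing R using (_*_; 0#) renaming (refl to ≈-refl)
  open Module M
  open Dendriform Dd
  open Aug Dd
  open CommutativeSemigroupProperties (CommutativeMonoid.commutativeSemigroup +ᴹ-commutativeMonoid)
    using (interchange)
  open SetoidReasoning ≈ᴹ-setoid

  0≻ : ∀ x → (0ᴹ ≻ x) ≈ᴹ 0ᴹ
  0≻ x = begin
    0ᴹ ≻ x          ≈⟨ ≻-cong (≈ᴹ-sym (*ₗ-zeroˡ 0ᴹ)) ≈ᴹ-refl ⟩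
    (0# *ₗ 0ᴹ) ≻ x  ≈⟨ ≻-*ˡ 0# 0ᴹ x ⟩
    0# *ₗ (0ᴹ ≻ x)  ≈⟨ *ₗ-zeroˡ _ ⟩
    0ᴹ              ∎

  ≺0 : ∀ x → (x ≺ 0ᴹ) ≈ᴹ 0ᴹ
  ≺0 x = begin
    x ≺ 0ᴹ          ≈⟨ ≺-cong ≈ᴹ-refl (≈ᴹ-sym (*ₗ-zeroˡ 0ᴹ)) ⟩
    x ≺ (0# *ₗ 0ᴹ)  ≈⟨ ≺-*ʳ 0# x 0ᴹ ⟩
    0# *ₗ (x ≺ 0ᴹ)  ≈⟨ *ₗ-zeroˡ _ ⟩
    0ᴹ              ∎

  ≈̄-refl : ∀ {u} → u ≈̄ u
  ≈̄-refl = record { vec≈ = ≈ᴹ-refl ; sca≈ = ≈-refl }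

  ̄≻-cong : ∀ {u u′ x x′} → u ≈̄ u′ → x ≈ᴹ x′ → (u ̄≻ x) ≈ᴹ (u′ ̄≻ x′)
  ̄≻-cong u≈u′ x≈x′ = +ᴹ-cong (≻-cong (_≈̄_.vec≈ u≈u′) x≈x′) (*ₗ-cong (_≈̄_.sca≈ u≈u′) x≈x′)

  ≺̄-cong : ∀ {u u′ x x′} → x ≈ᴹ x′ → u ≈̄ u′ → (x ≺̄ u) ≈ᴹ (x′ ≺̄ u′)
  ≺̄-cong x≈x′ u≈u′ = +ᴹ-cong (≺-cong x≈x′ (_≈̄_.vec≈ u≈u′)) (*ₗ-cong (_≈̄_.sca≈ u≈u′) x≈x′)

  ̄≻-distribˡ : ∀ u x y → (u ̄≻ (x +ᴹ y)) ≈ᴹ ((u ̄≻ x) +ᴹ (u ̄≻ y))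
  ̄≻-distribˡ ⟨ d , r ⟩ x y =
    ≈ᴹ-trans (+ᴹ-cong (≻-+ʳ d x y) (*ₗ-distribˡ r x y)) (interchange _ _ _ _)

  ̄≻-distribʳ : ∀ u v x → ((u +̄ v) ̄≻ x) ≈ᴹ ((u ̄≻ x) +ᴹ (v ̄≻ x))
  ̄≻-distribʳ ⟨ d , r ⟩ ⟨ e , s ⟩ x =
    ≈ᴹ-trans (+ᴹ-cong (≻-+ˡ d e x) (*ₗ-distribʳ x r s)) (interchange _ _ _ _)

  ≺̄-distribʳ : ∀ x y w → ((x +ᴹ y) ≺̄ w) ≈ᴹ ((x ≺̄ w) +ᴹ (y ≺̄ w))
  ≺̄-distribʳ x y ⟨ e , s ⟩ =
    ≈ᴹ-trans (+ᴹ-cong (≺-+ˡ x y e) (*ₗ-distribˡ s x y)) (interchange _ _ _ _)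

  ≺̄-distribˡ : ∀ x v w → (x ≺̄ (v +̄ w)) ≈ᴹ ((x ≺̄ v) +ᴹ (x ≺̄ w))
  ≺̄-distribˡ x ⟨ e , s ⟩ ⟨ f , t ⟩ =
    ≈ᴹ-trans (+ᴹ-cong (≺-+ʳ x e f) (*ₗ-distribʳ x s t)) (interchange _ _ _ _)

  ̄≻-zeroˡ : ∀ x → (0̄ ̄≻ x) ≈ᴹ 0ᴹ
  ̄≻-zeroˡ x = ≈ᴹ-trans (+ᴹ-cong (0≻ x) (*ₗ-zeroˡ x)) (+ᴹ-identityˡ 0ᴹ)

  ≺̄-zeroʳ : ∀ x → (x ≺̄ 0̄) ≈ᴹ 0ᴹ
  ≺̄-zeroʳ x = ≈ᴹ-trans (+ᴹ-cong (≺0 x) (*ₗ-zeroˡ x)) (+ᴹ-identityˡ 0ᴹ)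

  ̄≻-identityˡ : ∀ x → (1̄ ̄≻ x) ≈ᴹ x
  ̄≻-identityˡ x = ≈ᴹ-trans (+ᴹ-cong (0≻ x) (*ₗ-identityˡ x)) (+ᴹ-identityˡ x)

  ≺̄-identityʳ : ∀ x → (x ≺̄ 1̄) ≈ᴹ x
  ≺̄-identityʳ x = ≈ᴹ-trans (+ᴹ-cong (≺0 x) (*ₗ-identityˡ x)) (+ᴹ-identityˡ x)

  ̄≻-assoc : ∀ u v x → ((u ∗̄ v) ̄≻ x) ≈ᴹ (u ̄≻ (v ̄≻ x))
  ̄≻-assoc ⟨ d , r ⟩ ⟨ e , s ⟩ x = begin
    ((d ∗ e) +ᴹ ((s *ₗ d) +ᴹ (r *ₗ e))) ≻ x +ᴹ (r * s) *ₗ x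
      ≈⟨ +ᴹ-cong (≻-+ˡ _ _ x) (*ₗ-assoc r s x) ⟩
    ((d ∗ e) ≻ x +ᴹ ((s *ₗ d) +ᴹ (r *ₗ e)) ≻ x) +ᴹ r *ₗ s *ₗ x
      ≈⟨ +ᴹ-cong (+ᴹ-cong (≈ᴹ-sym (dend₃ d e x)) (≈ᴹ-trans (≻-+ˡ _ _ x) (+ᴹ-cong (≻-*ˡ s d x) (≻-*ˡ r e x))))
                 ≈ᴹ-refl ⟩
    (d ≻ (e ≻ x) +ᴹ (s *ₗ (d ≻ x) +ᴹ r *ₗ (e ≻ x))) +ᴹ r *ₗ s *ₗ x
      ≈⟨ +ᴹ-cong (≈ᴹ-sym (+ᴹ-assoc _ _ _)) ≈ᴹ-refl ⟩
    ((d ≻ (e ≻ x) +ᴹ s *ₗ (d ≻ x)) +ᴹ r *ₗ (e ≻ x)) +ᴹ r *ₗ s *ₗ x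
      ≈⟨ +ᴹ-assoc _ _ _ ⟩
    (d ≻ (e ≻ x) +ᴹ s *ₗ (d ≻ x)) +ᴹ (r *ₗ (e ≻ x) +ᴹ r *ₗ s *ₗ x)
      ≈⟨ ≈ᴹ-sym (+ᴹ-cong (≈ᴹ-trans (≻-+ʳ d _ _) (+ᴹ-cong ≈ᴹ-refl (≻-*ʳ s d x))) (*ₗ-distribˡ r _ _)) ⟩
    d ≻ (e ≻ x +ᴹ s *ₗ x) +ᴹ r *ₗ (e ≻ x +ᴹ s *ₗ x)
      ∎

  ≺̄-assoc : ∀ x v w → ((x ≺̄ v) ≺̄ w) ≈ᴹ (x ≺̄ (v ∗̄ w))
  ≺̄-assoc x ⟨ e , s ⟩ ⟨ f , t ⟩ = begin
    (x ≺ e +ᴹ s *ₗ x) ≺ f +ᴹ t *ₗ (x ≺ e +ᴹ s *ₗ x)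
      ≈⟨ +ᴹ-cong (≈ᴹ-trans (≺-+ˡ _ _ f) (+ᴹ-cong ≈ᴹ-refl (≺-*ˡ s x f)))
                 (≈ᴹ-trans (*ₗ-distribˡ t _ _) (+ᴹ-cong ≈ᴹ-refl (*ₗ-comm t s x))) ⟩
    ((x ≺ e) ≺ f +ᴹ s *ₗ (x ≺ f)) +ᴹ (t *ₗ (x ≺ e) +ᴹ s *ₗ t *ₗ x)
      ≈⟨ ≈ᴹ-sym (+ᴹ-assoc _ _ _) ⟩
    (((x ≺ e) ≺ f +ᴹ s *ₗ (x ≺ f)) +ᴹ t *ₗ (x ≺ e)) +ᴹ s *ₗ t *ₗ x
      ≈⟨ +ᴹ-cong (≈ᴹ-trans (+ᴹ-assoc _ _ _) (+ᴹ-cong ≈ᴹ-refl (+ᴹ-comm _ _))) (≈ᴹ-sym (*ₗ-assoc s t x)) ⟩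
    ((x ≺ e) ≺ f +ᴹ (t *ₗ (x ≺ e) +ᴹ s *ₗ (x ≺ f))) +ᴹ (s * t) *ₗ x
      ≈⟨ +ᴹ-cong (+ᴹ-cong (dend₁ x e f) (≈ᴹ-sym (≈ᴹ-trans (≺-+ʳ x _ _) (+ᴹ-cong (≺-*ʳ t x e) (≺-*ʳ s x f)))))
                 ≈ᴹ-refl ⟩
    (x ≺ (e ∗ f) +ᴹ x ≺ ((t *ₗ e) +ᴹ (s *ₗ f))) +ᴹ (s * t) *ₗ x
      ≈⟨ +ᴹ-cong (≈ᴹ-sym (≺-+ʳ x _ _)) ≈ᴹ-refl ⟩
    x ≺ ((e ∗ f) +ᴹ ((t *ₗ e) +ᴹ (s *ₗ f))) +ᴹ (s * t) *ₗ x
      ∎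

  ̄≻-≺̄-assoc : ∀ u x v → ((u ̄≻ x) ≺̄ v) ≈ᴹ (u ̄≻ (x ≺̄ v))
  ̄≻-≺̄-assoc ⟨ d , r ⟩ x ⟨ e , s ⟩ = begin
    (d ≻ x +ᴹ r *ₗ x) ≺ e +ᴹ s *ₗ (d ≻ x +ᴹ r *ₗ x)
      ≈⟨ +ᴹ-cong (≈ᴹ-trans (≺-+ˡ _ _ e) (+ᴹ-cong (dend₂ d x e) (≺-*ˡ r x e)))
                 (≈ᴹ-trans (*ₗ-distribˡ s _ _) (+ᴹ-cong ≈ᴹ-refl (*ₗ-comm s r x))) ⟩
    (d ≻ (x ≺ e) +ᴹ r *ₗ (x ≺ e)) +ᴹ (s *ₗ (d ≻ x) +ᴹ r *ₗ s *ₗ x)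
      ≈⟨ interchange _ _ _ _ ⟩
    (d ≻ (x ≺ e) +ᴹ s *ₗ (d ≻ x)) +ᴹ (r *ₗ (x ≺ e) +ᴹ r *ₗ s *ₗ x)
      ≈⟨ ≈ᴹ-sym (+ᴹ-cong (≈ᴹ-trans (≻-+ʳ d _ _) (+ᴹ-cong ≈ᴹ-refl (≻-*ʳ s d x))) (*ₗ-distribˡ r _ _)) ⟩
    d ≻ (x ≺ e +ᴹ s *ₗ x) +ᴹ r *ₗ (x ≺ e +ᴹ s *ₗ x)
      ∎

  sumᴹ-cong-≤ : ∀ n {f g : ℕ → Carrierᴹ} → (∀ {i} → i ≤ n → f i ≈ᴹ g i) → sumᴹ n f ≈ᴹ sumᴹ n g
  sumᴹ-cong-≤ zero    f≈g = f≈g z≤n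
  sumᴹ-cong-≤ (suc n) f≈g = +ᴹ-cong (sumᴹ-cong-≤ n (λ i≤n → f≈g (m≤n⇒m≤1+n i≤n))) (f≈g ≤-refl)

  sumᴹ-cong : ∀ n {f g : ℕ → Carrierᴹ} → (∀ i → f i ≈ᴹ g i) → sumᴹ n f ≈ᴹ sumᴹ n g
  sumᴹ-cong n f≈g = sumᴹ-cong-≤ n (λ {i} _ → f≈g i)

  sumᴹ-+ᴹ : ∀ n (f g : ℕ → Carrierᴹ) → sumᴹ n (λ i → f i +ᴹ g i) ≈ᴹ (sumᴹ n f +ᴹ sumᴹ n g)
  sumᴹ-+ᴹ zero    f g = ≈ᴹ-refl
  sumᴹ-+ᴹ (suc n) f g = ≈ᴹ-trans (+ᴹ-cong (sumᴹ-+ᴹ n f g) ≈ᴹ-refl) (interchange _ _ _ _)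

  sumᴹ-zero : ∀ n {f : ℕ → Carrierᴹ} → (∀ {i} → i ≤ n → f i ≈ᴹ 0ᴹ) → sumᴹ n f ≈ᴹ 0ᴹ
  sumᴹ-zero zero    f≈0 = f≈0 z≤n
  sumᴹ-zero (suc n) f≈0 =
    ≈ᴹ-trans (+ᴹ-cong (sumᴹ-zero n (λ i≤n → f≈0 (m≤n⇒m≤1+n i≤n))) (f≈0 ≤-refl)) (+ᴹ-identityˡ 0ᴹ)

  sumᴹ-head : ∀ n {f : ℕ → Carrierᴹ} → (∀ i → f (suc i) ≈ᴹ 0ᴹ) → sumᴹ n f ≈ᴹ f 0
  sumᴹ-head zero    f≈0 = ≈ᴹ-refl
  sumᴹ-head (suc n) f≈0 = ≈ᴹ-trans (+ᴹ-cong (sumᴹ-head n f≈0) (f≈0 n)) (+ᴹ-identityʳ _)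

  sumᴹ-last : ∀ n {f : ℕ → Carrierᴹ} → (∀ {i} → i < n → f i ≈ᴹ 0ᴹ) → sumᴹ n f ≈ᴹ f n
  sumᴹ-last zero    f≈0 = ≈ᴹ-refl
  sumᴹ-last (suc n) f≈0 = ≈ᴹ-trans (+ᴹ-cong (sumᴹ-zero n (λ i≤n → f≈0 (s≤s i≤n))) ≈ᴹ-refl) (+ᴹ-identityˡ _)

  ̄≻-sumᴹ : ∀ n u (f : ℕ → Carrierᴹ) → (u ̄≻ sumᴹ n f) ≈ᴹ sumᴹ n (λ i → u ̄≻ f i)
  ̄≻-sumᴹ zero    u f = ≈ᴹ-refl
  ̄≻-sumᴹ (suc n) u f = ≈ᴹ-trans (̄≻-distribˡ u _ _) (+ᴹ-cong (̄≻-sumᴹ n u f) ≈ᴹ-refl)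

  sum̄-̄≻ : ∀ n (F : ℕ → D̄) x → (sum̄ n F ̄≻ x) ≈ᴹ sumᴹ n (λ i → F i ̄≻ x)
  sum̄-̄≻ zero    F x = ≈ᴹ-refl
  sum̄-̄≻ (suc n) F x = ≈ᴹ-trans (̄≻-distribʳ _ _ x) (+ᴹ-cong (sum̄-̄≻ n F x) ≈ᴹ-refl)

  sumᴹ-≺̄ : ∀ n (f : ℕ → Carrierᴹ) w → (sumᴹ n f ≺̄ w) ≈ᴹ sumᴹ n (λ i → f i ≺̄ w)
  sumᴹ-≺̄ zero    f w = ≈ᴹ-refl
  sumᴹ-≺̄ (suc n) f w = ≈ᴹ-trans (≺̄-distribʳ _ _ w) (+ᴹ-cong (sumᴹ-≺̄ n f w) ≈ᴹ-refl)

  ≺̄-sum̄ : ∀ n x (F : ℕ → D̄) → (x ≺̄ sum̄ n F) ≈ᴹ sumᴹ n (λ i → x ≺̄ F i)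
  ≺̄-sum̄ zero    x F = ≈ᴹ-refl
  ≺̄-sum̄ (suc n) x F = ≈ᴹ-trans (≺̄-distribˡ x _ _) (+ᴹ-cong (≺̄-sum̄ n x F) ≈ᴹ-refl)

  -- Both sides sum g i j over the triangle i + j ≤ n, by rows and by anti-diagonals.
  sumᴹ-triangle : ∀ n (g : ℕ → ℕ → Carrierᴹ) →
    sumᴹ n (λ i → sumᴹ (n ∸ i) (g i)) ≈ᴹ sumᴹ n (λ k → sumᴹ k (λ i → g i (k ∸ i)))
  sumᴹ-triangle zero    g = ≈ᴹ-refl
  sumᴹ-triangle (suc n) g = begin
    sumᴹ n (λ i → sumᴹ (suc n ∸ i) (g i)) +ᴹ sumᴹ (n ∸ n) (g (suc n))
      ≈⟨ +ᴹ-cong (sumᴹ-cong-≤ n split-row) last-row ⟩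
    sumᴹ n (λ i → sumᴹ (n ∸ i) (g i) +ᴹ diagonal i) +ᴹ diagonal (suc n)
      ≈⟨ +ᴹ-cong (sumᴹ-+ᴹ n _ diagonal) ≈ᴹ-refl ⟩
    (sumᴹ n (λ i → sumᴹ (n ∸ i) (g i)) +ᴹ sumᴹ n diagonal) +ᴹ diagonal (suc n)
      ≈⟨ +ᴹ-assoc _ _ _ ⟩
    sumᴹ n (λ i → sumᴹ (n ∸ i) (g i)) +ᴹ sumᴹ (suc n) diagonal
      ≈⟨ +ᴹ-cong (sumᴹ-triangle n g) ≈ᴹ-refl ⟩
    sumᴹ n (λ k → sumᴹ k (λ i → g i (k ∸ i))) +ᴹ sumᴹ (suc n) diagonal
      ∎
    where
      diagonal : ℕ → Carrierᴹ
      diagonal i = g i (suc n ∸ i)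
      split-row : ∀ {i} → i ≤ n → sumᴹ (suc n ∸ i) (g i) ≈ᴹ (sumᴹ (n ∸ i) (g i) +ᴹ diagonal i)
      split-row {i} i≤n rewrite +-∸-assoc 1 i≤n = ≈ᴹ-refl
      last-row : sumᴹ (n ∸ n) (g (suc n)) ≈ᴹ g (suc n) (n ∸ n)
      last-row rewrite n∸n≡0 n = ≈ᴹ-refl

  -- Both sides sum h i j l over i + j + l = n.
  sumᴹ-reassoc : ∀ n (h : ℕ → ℕ → ℕ → Carrierᴹ) →
    sumᴹ n (λ i → sumᴹ (n ∸ i) (λ j → h i j (n ∸ i ∸ j)))
      ≈ᴹ sumᴹ n (λ k → sumᴹ k (λ i → h i (k ∸ i) (n ∸ k)))
  sumᴹ-reassoc n h = begin
    sumᴹ n (λ i → sumᴹ (n ∸ i) (λ j → h i j (n ∸ i ∸ j)))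
      ≈⟨ sumᴹ-cong n (λ i → sumᴹ-cong (n ∸ i) (λ j →
           ≈ᴹ-reflexive (P.cong (h i j) (∸-+-assoc n i j)))) ⟩
    sumᴹ n (λ i → sumᴹ (n ∸ i) (λ j → h i j (n ∸ (i + j))))
      ≈⟨ sumᴹ-triangle n (λ i j → h i j (n ∸ (i + j))) ⟩
    sumᴹ n (λ k → sumᴹ k (λ i → h i (k ∸ i) (n ∸ (i + (k ∸ i)))))
      ≈⟨ sumᴹ-cong n (λ k → sumᴹ-cong-≤ k (λ {i} i≤k →
           ≈ᴹ-reflexive (P.cong (λ t → h i (k ∸ i) (n ∸ t)) (m+[n∸m]≡n i≤k)))) ⟩
    sumᴹ n (λ k → sumᴹ k (λ i → h i (k ∸ i) (n ∸ k)))
      ∎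

  ≈ₚ-setoid : Setoid m ℓm
  ≈ₚ-setoid = record
    { Carrier       = PS
    ; _≈_           = _≈ₚ_
    ; isEquivalence = record
      { refl  = λ _ → ≈ᴹ-refl
      ; sym   = λ x≈y n → ≈ᴹ-sym (x≈y n)
      ; trans = λ x≈y y≈z n → ≈ᴹ-trans (x≈y n) (y≈z n)
      }
    }

  ≻ₚ-congʳ : ∀ W W′ → W ≈̄ₚ W′ → ∀ x → (W ≻ₚ x) ≈ₚ (W′ ≻ₚ x)
  ≻ₚ-congʳ _ _ W≈W′ x n = sumᴹ-cong n (λ i → ̄≻-cong (W≈W′ i) ≈ᴹ-refl)

  ≺ₚ-congˡ : ∀ W W′ → W ≈̄ₚ W′ → ∀ x → (x ≺ₚ W) ≈ₚ (x ≺ₚ W′)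
  ≺ₚ-congˡ _ _ W≈W′ x n = sumᴹ-cong n (λ i → ≺̄-cong ≈ᴹ-refl (W≈W′ (n ∸ i)))

  ≺ₚ-congʳ : ∀ {x x′} W → x ≈ₚ x′ → (x ≺ₚ W) ≈ₚ (x′ ≺ₚ W)
  ≺ₚ-congʳ W x≈x′ n = sumᴹ-cong n (λ i → ≺̄-cong (x≈x′ i) ≈̄-refl)

  ≻ₚ-identityˡ : ∀ x → (1ₚ ≻ₚ x) ≈ₚ x
  ≻ₚ-identityˡ x n = ≈ᴹ-trans (sumᴹ-head n (λ i → ̄≻-zeroˡ _)) (̄≻-identityˡ (x n))

  ≺ₚ-identityʳ : ∀ x → (x ≺ₚ 1ₚ) ≈ₚ x
  ≺ₚ-identityʳ x n = ≈ᴹ-trans (sumᴹ-last n off-diagonal) last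
    where
      1ₚ-positive : ∀ {k} → 0 < k → 1ₚ k ≡ 0̄
      1ₚ-positive {suc k} _ = P.refl
      off-diagonal : ∀ {i} → i < n → (x i ≺̄ 1ₚ (n ∸ i)) ≈ᴹ 0ᴹ
      off-diagonal {i} i<n =
        ≈ᴹ-trans (≈ᴹ-reflexive (P.cong (x i ≺̄_) (1ₚ-positive (m<n⇒0<n∸m i<n)))) (≺̄-zeroʳ (x i))
      last : (x n ≺̄ 1ₚ (n ∸ n)) ≈ᴹ x n
      last rewrite n∸n≡0 n = ≺̄-identityʳ (x n)

  ≻ₚ-assoc : ∀ (W V : PS̄) (x : PS) → ((W ∗ₚ V) ≻ₚ x) ≈ₚ (W ≻ₚ (V ≻ₚ x))
  ≻ₚ-assoc W V x n = begin
    sumᴹ n (λ k → sum̄ k (λ i → W i ∗̄ V (k ∸ i)) ̄≻ x (n ∸ k))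
      ≈⟨ sumᴹ-cong n (λ k → sum̄-̄≻ k _ _) ⟩
    sumᴹ n (λ k → sumᴹ k (λ i → (W i ∗̄ V (k ∸ i)) ̄≻ x (n ∸ k)))
      ≈⟨ ≈ᴹ-sym (sumᴹ-reassoc n (λ i j l → (W i ∗̄ V j) ̄≻ x l)) ⟩
    sumᴹ n (λ i → sumᴹ (n ∸ i) (λ j → (W i ∗̄ V j) ̄≻ x (n ∸ i ∸ j)))
      ≈⟨ sumᴹ-cong n (λ i → ≈ᴹ-trans (sumᴹ-cong (n ∸ i) (λ j → ̄≻-assoc (W i) (V j) _))
                                     (≈ᴹ-sym (̄≻-sumᴹ (n ∸ i) (W i) _))) ⟩
    sumᴹ n (λ i → W i ̄≻ sumᴹ (n ∸ i) (λ j → V j ̄≻ x (n ∸ i ∸ j)))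
      ∎

  ≺ₚ-assoc : ∀ (x : PS) (V W : PS̄) → ((x ≺ₚ V) ≺ₚ W) ≈ₚ (x ≺ₚ (V ∗ₚ W))
  ≺ₚ-assoc x V W n = begin
    sumᴹ n (λ k → sumᴹ k (λ i → x i ≺̄ V (k ∸ i)) ≺̄ W (n ∸ k))
      ≈⟨ sumᴹ-cong n (λ k → sumᴹ-≺̄ k _ _) ⟩
    sumᴹ n (λ k → sumᴹ k (λ i → (x i ≺̄ V (k ∸ i)) ≺̄ W (n ∸ k)))
      ≈⟨ ≈ᴹ-sym (sumᴹ-reassoc n (λ i j l → (x i ≺̄ V j) ≺̄ W l)) ⟩
    sumᴹ n (λ i → sumᴹ (n ∸ i) (λ j → (x i ≺̄ V j) ≺̄ W (n ∸ i ∸ j)))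
      ≈⟨ sumᴹ-cong n (λ i → ≈ᴹ-trans (sumᴹ-cong (n ∸ i) (λ j → ≺̄-assoc (x i) (V j) _))
                                     (≈ᴹ-sym (≺̄-sum̄ (n ∸ i) (x i) _))) ⟩
    sumᴹ n (λ i → x i ≺̄ sum̄ (n ∸ i) (λ j → V j ∗̄ W (n ∸ i ∸ j)))
      ∎

  ≻ₚ-≺ₚ-assoc : ∀ (W : PS̄) (x : PS) (V : PS̄) → ((W ≻ₚ x) ≺ₚ V) ≈ₚ (W ≻ₚ (x ≺ₚ V))
  ≻ₚ-≺ₚ-assoc W x V n = begin
    sumᴹ n (λ k → sumᴹ k (λ i → W i ̄≻ x (k ∸ i)) ≺̄ V (n ∸ k))
      ≈⟨ sumᴹ-cong n (λ k → ≈ᴹ-trans (sumᴹ-≺̄ k _ _) (sumᴹ-cong k (λ i → ̄≻-≺̄-assoc (W i) _ _))) ⟩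
    sumᴹ n (λ k → sumᴹ k (λ i → W i ̄≻ (x (k ∸ i) ≺̄ V (n ∸ k))))
      ≈⟨ ≈ᴹ-sym (sumᴹ-reassoc n (λ i j l → W i ̄≻ (x j ≺̄ V l))) ⟩
    sumᴹ n (λ i → sumᴹ (n ∸ i) (λ j → W i ̄≻ (x j ≺̄ V (n ∸ i ∸ j))))
      ≈⟨ sumᴹ-cong n (λ i → ≈ᴹ-sym (̄≻-sumᴹ (n ∸ i) (W i) _)) ⟩
    sumᴹ n (λ i → W i ̄≻ sumᴹ (n ∸ i) (λ j → x j ≺̄ V (n ∸ i ∸ j)))
      ∎

module Conjugation {c ℓ m ℓm} {R : CommutativeRing c ℓ} {M : Module R m ℓm}
                   (Dd : Dendriform M) where
  open Module M using (≈ᴹ-refl)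
  open Aug Dd
  open DendriformActions Dd
  open SetoidReasoning ≈ₚ-setoid

  ≻ₚ-cancel : ∀ W V → (W ∗ₚ V) ≈̄ₚ 1ₚ → ∀ x → (W ≻ₚ (V ≻ₚ x)) ≈ₚ x
  ≻ₚ-cancel W V WV≈1 x = begin
    W ≻ₚ (V ≻ₚ x)   ≈⟨ ≻ₚ-assoc W V x ⟨
    (W ∗ₚ V) ≻ₚ x   ≈⟨ ≻ₚ-congʳ (W ∗ₚ V) 1ₚ WV≈1 x ⟩
    1ₚ ≻ₚ x         ≈⟨ ≻ₚ-identityˡ x ⟩
    x               ∎

  ≺ₚ-cancel : ∀ V W → (V ∗ₚ W) ≈̄ₚ 1ₚ → ∀ x → ((x ≺ₚ V) ≺ₚ W) ≈ₚ x
  ≺ₚ-cancel V W VW≈1 x = begin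
    (x ≺ₚ V) ≺ₚ W   ≈⟨ ≺ₚ-assoc x V W ⟩
    x ≺ₚ (V ∗ₚ W)   ≈⟨ ≺ₚ-congˡ (V ∗ₚ W) 1ₚ VW≈1 x ⟩
    x ≺ₚ 1ₚ         ≈⟨ ≺ₚ-identityʳ x ⟩
    x               ∎

  -- (A ∗ B)⁻¹ = B⁻¹ ∗ A⁻¹, seen through the right action.
  ≺ₚ-inverse-∗ₚ : ∀ A Ai B Bi ABi → (Ai ∗ₚ A) ≈̄ₚ 1ₚ → (Bi ∗ₚ B) ≈̄ₚ 1ₚ →
    ((A ∗ₚ B) ∗ₚ ABi) ≈̄ₚ 1ₚ → ∀ y → ((y ≺ₚ Bi) ≺ₚ Ai) ≈ₚ (y ≺ₚ ABi)
  ≺ₚ-inverse-∗ₚ A Ai B Bi ABi AiA≈1 BiB≈1 ABABi≈1 y = begin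
    z                          ≈⟨ ≺ₚ-cancel (A ∗ₚ B) ABi ABABi≈1 z ⟨
    (z ≺ₚ (A ∗ₚ B)) ≺ₚ ABi     ≈⟨ ≺ₚ-congʳ ABi (≺ₚ-assoc z A B) ⟨
    ((z ≺ₚ A) ≺ₚ B) ≺ₚ ABi     ≈⟨ ≺ₚ-congʳ ABi (≺ₚ-congʳ B (≺ₚ-cancel Ai A AiA≈1 (y ≺ₚ Bi))) ⟩
    ((y ≺ₚ Bi) ≺ₚ B) ≺ₚ ABi    ≈⟨ ≺ₚ-congʳ ABi (≺ₚ-cancel Bi B BiB≈1 y) ⟩
    y ≺ₚ ABi                   ∎
    where z = (y ≺ₚ Bi) ≺ₚ Ai

  Θ-∗ₚ : ∀ A Ai B Bi ABi → (Ai ∗ₚ A) ≈̄ₚ 1ₚ → (Bi ∗ₚ B) ≈̄ₚ 1ₚ →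
    ((A ∗ₚ B) ∗ₚ ABi) ≈̄ₚ 1ₚ → ∀ x → Θ A Ai (Θ B Bi x) ≈ₚ Θ (A ∗ₚ B) ABi x
  Θ-∗ₚ A Ai B Bi ABi AiA≈1 BiB≈1 ABABi≈1 x = begin
    (A ≻ₚ ((B ≻ₚ x) ≺ₚ Bi)) ≺ₚ Ai     ≈⟨ ≺ₚ-congʳ Ai (≻ₚ-≺ₚ-assoc A (B ≻ₚ x) Bi) ⟨
    ((A ≻ₚ (B ≻ₚ x)) ≺ₚ Bi) ≺ₚ Ai     ≈⟨ ≺ₚ-congʳ Ai (≺ₚ-congʳ Bi (≻ₚ-assoc A B x)) ⟨
    (((A ∗ₚ B) ≻ₚ x) ≺ₚ Bi) ≺ₚ Ai     ≈⟨ ≺ₚ-inverse-∗ₚ A Ai B Bi ABi AiA≈1 BiB≈1 ABABi≈1 ((A ∗ₚ B) ≻ₚ x) ⟩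
    ((A ∗ₚ B) ≻ₚ x) ≺ₚ ABi            ∎

  Θ-cancel : ∀ W V → (W ∗ₚ V) ≈̄ₚ 1ₚ → ∀ x → Θ W V (Θ V W x) ≈ₚ x
  Θ-cancel W V WV≈1 x = begin
    (W ≻ₚ ((V ≻ₚ x) ≺ₚ W)) ≺ₚ V   ≈⟨ ≺ₚ-congʳ V (≻ₚ-≺ₚ-assoc W (V ≻ₚ x) W) ⟨
    ((W ≻ₚ (V ≻ₚ x)) ≺ₚ W) ≺ₚ V   ≈⟨ ≺ₚ-congʳ V (≺ₚ-congʳ W (≻ₚ-cancel W V WV≈1 x)) ⟩
    (x ≺ₚ W) ≺ₚ V                 ≈⟨ ≺ₚ-cancel W V WV≈1 x ⟩
    x                             ∎

mainTheorem5 : ∀ {c ℓ m ℓm} (R : CommutativeRing c ℓ) → IsField R → CharZero R →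
    (M : Module R m ℓm) (Dd : Dendriform M) →
    let open Aug Dd in
    (a b : Module.Carrierᴹ M) (A B : PS̄) →
    A ≈̄ₚ 1ₚ +̄ₚ (λ· ιₚ (A ≻ₚ constᴹ a)) →
    B ≈̄ₚ 1ₚ +̄ₚ (λ· ιₚ (B ≻ₚ constᴹ b)) →
    (Ai Bi ABi : PS̄) →
    IsInverse A Ai → IsInverse B Bi → IsInverse (A ∗ₚ B) ABi →
    (∀ (x : PS) → Θ A Ai (Θ B Bi x) ≈ₚ Θ (A ∗ₚ B) ABi x)
    × (∀ (x : PS) → (Θ A Ai (Θ Ai A x) ≈ₚ x) × (Θ Ai A (Θ A Ai x) ≈ₚ x))
mainTheorem5 _ _ _ _ Dd _ _ A B _ _ Ai Bi ABi (AAi≈1 , AiA≈1) (_ , BiB≈1) (ABABi≈1 , _) =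
    Θ-∗ₚ A Ai B Bi ABi AiA≈1 BiB≈1 ABABi≈1
  , λ x → Θ-cancel A Ai AAi≈1 x , Θ-cancel Ai A AiA≈1 x
  where open Conjugation Dd
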